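{- Let $\mathcal{H}=(V,H)$ be a matroid. Then $\mathcal{H}^{\mathrm{up}}=(V,H^{\mathrm{up}})$ is a matroid.
   Context: A simplicial complex is a pair $(V,H)$ where $V$ is a finite nonempty set and $H\subseteq 2^V$ contains every singleton and is closed under taking subsets. It is a matroid if it satisfies the exchange property: for all $I,J\in H$ with $|I|=|J|+1$ there exists $i\in I\setminus J$ with $J\cup\{i\}\in H$. Define $H^{\mathrm{up}} = H\cup\{I\cup\{p\} : I\in H,\ p\in V\setminus I\}$. -}

module Defs where

open import Data.Nat using (ℕ; suc)
open import Data.Fin using (Fin)
open import Data.Fin.Subset using (Subset; ⁅_⁆; _∈_; _∉_; _⊆_; _∪_; ∣_∣)
open import Data.Product using (Σ; _×_; ∃; ∃-syntax; _,_)
open import Data.Sum using (_⊎_)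
open import Relation.Binary.PropositionalEquality using (_≡_)

-- Ground set V = Fin n (finite); nonemptiness is imposed as n ≥ 1 in the statement.
-- A family H ⊆ 2^V is given as a predicate on subsets.
Family : ℕ → Set₁
Family n = Subset n → Set

record IsSimplicialComplex {n : ℕ} (H : Family n) : Set where
  field
    singletons : ∀ (v : Fin n) → H ⁅ v ⁆
    downClosed : ∀ {I J : Subset n} → J ⊆ I → H I → H J

record IsMatroid {n : ℕ} (H : Family n) : Set where
  field
    isComplex : IsSimplicialComplex H
    exchange  : ∀ (I J : Subset n) → H I → H J → ∣ I ∣ ≡ suc ∣ J ∣ →
                ∃[ i ] (i ∈ I × i ∉ J × H (J ∪ ⁅ i ⁆))

Up : {n : ℕ} → Family n → Family n
Up {n} H K = H K ⊎ (∃[ I ] ∃[ p ] (H I × p ∉ I × K ≡ I ∪ ⁅ p ⁆))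

{-# OPTIONS --safe #-}
-- Down-closure is
-- inherited: a subset of I ∪ {p} either avoids p, and then lies in I, or is (J - p) ∪ {p}
-- with J - p ⊆ I.  For the exchange of I against J with |I| = |J| + 1: if J ∈ H, any
-- i ∈ I \ J works, since J ∪ {i} ∈ H^up by definition.  Otherwise J = J' ∪ {q} with J' ∈ H,
-- and I contains some I' ∈ H with |I'| = |J'| + 1.  Exchange in H yields i ∈ I' \ J' with
-- J' ∪ {i} ∈ H; if i = q then J ∈ H and we are in the first case, otherwise
-- J ∪ {i} = (J' ∪ {i}) ∪ {q} ∈ H^up.
module Submission where

open import Defs
open import Data.Nat using (ℕ; suc; _<_; s≤s; z≤n)
open import Data.Nat.Properties using (suc-injective; <⇒≤; ≤-reflexive)
open import Data.Bool using (true; false)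
open import Data.Fin using (zero; suc; _≟_)
open import Data.Fin.Subset using (Subset; ⁅_⁆; _∈_; _∉_; _⊆_; _∪_; _-_; ∣_∣; ⊥)
open import Data.Fin.Subset.Properties
  using (_∈?_; drop-there; x∈⁅y⁆⇒x≡y; x∈p∪q⁻; p⊆p∪q; p─q⊆p; ∪-identityʳ; ∪-assoc; ∪-comm;
         p─⊥≡p; ∣⊥∣≡0)
open import Data.Vec using (_∷_; here; there)
open import Data.Product using (∃-syntax; _×_; _,_)
open import Data.Sum using (inj₁; inj₂)
open import Data.Empty using (⊥-elim)
open import Function using (_∘_)
open import Relation.Nullary using (yes; no)
open import Relation.Binary.PropositionalEquality
  using (_≡_; _≢_; refl; sym; trans; cong; subst; subst₂; module ≡-Reasoning)

∣p∪⁅x⁆∣≡1+∣p∣ : ∀ {n} (p : Subset n) {x} → x ∉ p → ∣ p ∪ ⁅ x ⁆ ∣ ≡ suc ∣ p ∣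
∣p∪⁅x⁆∣≡1+∣p∣ (true  ∷ p) {zero}  x∉p = ⊥-elim (x∉p here)
∣p∪⁅x⁆∣≡1+∣p∣ (false ∷ p) {zero}  x∉p = cong (suc ∘ ∣_∣) (∪-identityʳ p)
∣p∪⁅x⁆∣≡1+∣p∣ (true  ∷ p) {suc x} x∉p = cong suc (∣p∪⁅x⁆∣≡1+∣p∣ p (x∉p ∘ there))
∣p∪⁅x⁆∣≡1+∣p∣ (false ∷ p) {suc x} x∉p = ∣p∪⁅x⁆∣≡1+∣p∣ p (x∉p ∘ there)

∃[x∈p∖q]-there : ∀ {n s t} {p q : Subset n} →
                 ∃[ x ] (x ∈ p × x ∉ q) → ∃[ x ] (x ∈ s ∷ p × x ∉ t ∷ q)
∃[x∈p∖q]-there (x , x∈p , x∉q) = suc x , there x∈p , x∉q ∘ drop-there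

∣q∣<∣p∣⇒∃[x∈p∖q] : ∀ {n} (p q : Subset n) → ∣ q ∣ < ∣ p ∣ → ∃[ x ] (x ∈ p × x ∉ q)
∣q∣<∣p∣⇒∃[x∈p∖q] (true  ∷ p) (false ∷ q) _         = zero , here , λ ()
∣q∣<∣p∣⇒∃[x∈p∖q] (true  ∷ p) (true  ∷ q) (s≤s q<p) = ∃[x∈p∖q]-there (∣q∣<∣p∣⇒∃[x∈p∖q] p q q<p)
∣q∣<∣p∣⇒∃[x∈p∖q] (false ∷ p) (false ∷ q) q<p       = ∃[x∈p∖q]-there (∣q∣<∣p∣⇒∃[x∈p∖q] p q q<p)
∣q∣<∣p∣⇒∃[x∈p∖q] (false ∷ p) (true  ∷ q) q<p       = ∃[x∈p∖q]-there (∣q∣<∣p∣⇒∃[x∈p∖q] p q (<⇒≤ q<p))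

x∉p-x : ∀ {n} (p : Subset n) x → x ∉ p - x
x∉p-x (_ ∷ p) zero    = λ ()
x∉p-x (_ ∷ p) (suc x) = x∉p-x p x ∘ drop-there

x∈p⇒p-x∪⁅x⁆≡p : ∀ {n} {p : Subset n} {x} → x ∈ p → (p - x) ∪ ⁅ x ⁆ ≡ p
x∈p⇒p-x∪⁅x⁆≡p {p = true  ∷ p} here = cong (true ∷_) (trans (∪-identityʳ _) (p─⊥≡p p))
x∈p⇒p-x∪⁅x⁆≡p {p = true  ∷ p} (there x∈p) = cong (true ∷_)  (x∈p⇒p-x∪⁅x⁆≡p x∈p)
x∈p⇒p-x∪⁅x⁆≡p {p = false ∷ p} (there x∈p) = cong (false ∷_) (x∈p⇒p-x∪⁅x⁆≡p x∈p)

x∈p⇒∣p∣≡1+∣p-x∣ : ∀ {n} {p : Subset n} {x} → x ∈ p → ∣ p ∣ ≡ suc ∣ p - x ∣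
x∈p⇒∣p∣≡1+∣p-x∣ {p = p} {x} x∈p =
  trans (cong ∣_∣ (sym (x∈p⇒p-x∪⁅x⁆≡p x∈p))) (∣p∪⁅x⁆∣≡1+∣p∣ (p - x) (x∉p-x p x))

⊆∪⁅x⁆∧x∉⇒⊆ : ∀ {n} {p q : Subset n} {x} → q ⊆ p ∪ ⁅ x ⁆ → x ∉ q → q ⊆ p
⊆∪⁅x⁆∧x∉⇒⊆ {p = p} {x = x} q⊆p∪x x∉q {y} y∈q with x∈p∪q⁻ p ⁅ x ⁆ (q⊆p∪x y∈q)
... | inj₁ y∈p = y∈p
... | inj₂ y∈x = ⊥-elim (x∉q (subst (_∈ _) (x∈⁅y⁆⇒x≡y x y∈x) y∈q))

x∉p∧x≢y⇒x∉p∪⁅y⁆ : ∀ {n} {p : Subset n} {x y} → x ∉ p → x ≢ y → x ∉ p ∪ ⁅ y ⁆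
x∉p∧x≢y⇒x∉p∪⁅y⁆ {p = p} {y = y} x∉p x≢y x∈p∪y with x∈p∪q⁻ p ⁅ y ⁆ x∈p∪y
... | inj₁ x∈p = x∉p x∈p
... | inj₂ x∈y = x≢y (x∈⁅y⁆⇒x≡y y x∈y)

p∪⁅x⁆∪⁅y⁆≡p∪⁅y⁆∪⁅x⁆ : ∀ {n} (p : Subset n) x y → (p ∪ ⁅ x ⁆) ∪ ⁅ y ⁆ ≡ (p ∪ ⁅ y ⁆) ∪ ⁅ x ⁆
p∪⁅x⁆∪⁅y⁆≡p∪⁅y⁆∪⁅x⁆ p x y = begin
  (p ∪ ⁅ x ⁆) ∪ ⁅ y ⁆  ≡⟨ ∪-assoc p ⁅ x ⁆ ⁅ y ⁆ ⟩
  p ∪ (⁅ x ⁆ ∪ ⁅ y ⁆)  ≡⟨ cong (p ∪_) (∪-comm ⁅ x ⁆ ⁅ y ⁆) ⟩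
  p ∪ (⁅ y ⁆ ∪ ⁅ x ⁆)  ≡⟨ ∪-assoc p ⁅ y ⁆ ⁅ x ⁆ ⟨
  (p ∪ ⁅ y ⁆) ∪ ⁅ x ⁆  ∎
  where open ≡-Reasoning

Augments : ∀ {n} → Family n → Subset n → Subset n → Set
Augments H I J = ∃[ i ] (i ∈ I × i ∉ J × H (J ∪ ⁅ i ⁆))

module _ {n : ℕ} {H : Family n} where

  Up-extend : ∀ {I p} → H I → p ∉ I → Up H (I ∪ ⁅ p ⁆)
  Up-extend {I} {p} hI p∉I = inj₂ (I , p , hI , p∉I , refl)

  Up-augments : ∀ {I J} → H J → ∣ J ∣ < ∣ I ∣ → Augments (Up H) I J
  Up-augments {I} {J} hJ J<I with ∣q∣<∣p∣⇒∃[x∈p∖q] I J J<I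
  ... | i , i∈I , i∉J = i , i∈I , i∉J , Up-extend hJ i∉J

  module _ (complex : IsSimplicialComplex H) where
    open IsSimplicialComplex complex

    Up-downClosed : ∀ {I J} → J ⊆ I → Up H I → Up H J
    Up-downClosed J⊆I (inj₁ hI) = inj₁ (downClosed J⊆I hI)
    Up-downClosed {J = J} J⊆I∪p (inj₂ (I , p , hI , _ , refl)) with p ∈? J
    ... | no  p∉J = inj₁ (downClosed (⊆∪⁅x⁆∧x∉⇒⊆ J⊆I∪p p∉J) hI)
    ... | yes p∈J = subst (Up H) (x∈p⇒p-x∪⁅x⁆≡p p∈J) (Up-extend hJ-p (x∉p-x J p))
      where
      hJ-p : H (J - p)
      hJ-p = downClosed (⊆∪⁅x⁆∧x∉⇒⊆ (J⊆I∪p ∘ p─q⊆p J ⁅ p ⁆) (x∉p-x J p)) hI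

    Up-isSimplicialComplex : IsSimplicialComplex (Up H)
    Up-isSimplicialComplex = record
      { singletons = inj₁ ∘ singletons
      ; downClosed = Up-downClosed
      }

    Up⇒∃H-subset-one-smaller : ∀ {I m} → Up H I → ∣ I ∣ ≡ suc m →
                               ∃[ I' ] (I' ⊆ I × H I' × ∣ I' ∣ ≡ m)
    Up⇒∃H-subset-one-smaller {I} (inj₁ hI) ∣I∣≡1+m
      with ∣q∣<∣p∣⇒∃[x∈p∖q] I ⊥ (subst₂ _<_ (sym (∣⊥∣≡0 n)) (sym ∣I∣≡1+m) (s≤s z≤n))
    ... | x , x∈I , _ =
      I - x , p─q⊆p I ⁅ x ⁆ , downClosed (p─q⊆p I ⁅ x ⁆) hI ,
      suc-injective (trans (sym (x∈p⇒∣p∣≡1+∣p-x∣ x∈I)) ∣I∣≡1+m)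
    Up⇒∃H-subset-one-smaller (inj₂ (I , p , hI , p∉I , refl)) ∣I∪p∣≡1+m =
      I , p⊆p∪q ⁅ p ⁆ , hI , suc-injective (trans (sym (∣p∪⁅x⁆∣≡1+∣p∣ I p∉I)) ∣I∪p∣≡1+m)

  module _ (matroid : IsMatroid H) where
    open IsMatroid matroid

    Up-exchange : ∀ I J → Up H I → Up H J → ∣ I ∣ ≡ suc ∣ J ∣ → Augments (Up H) I J
    Up-exchange I J _ (inj₁ hJ) ∣I∣≡1+∣J∣ = Up-augments hJ (≤-reflexive (sym ∣I∣≡1+∣J∣))
    Up-exchange I J upI (inj₂ (J' , q , hJ' , q∉J' , refl)) ∣I∣≡1+∣J∣
      with Up⇒∃H-subset-one-smaller isComplex upI
             (trans ∣I∣≡1+∣J∣ (cong suc (∣p∪⁅x⁆∣≡1+∣p∣ J' q∉J')))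
    ... | I' , I'⊆I , hI' , ∣I'∣≡1+∣J'∣ with exchange I' J' hI' hJ' ∣I'∣≡1+∣J'∣
    ...   | i , i∈I' , i∉J' , hJ'∪i with i ≟ q
    ...     | yes refl = Up-augments hJ'∪i (≤-reflexive (sym ∣I∣≡1+∣J∣))
    ...     | no  i≢q  =
      i , I'⊆I i∈I' , x∉p∧x≢y⇒x∉p∪⁅y⁆ i∉J' i≢q ,
      subst (Up H) (p∪⁅x⁆∪⁅y⁆≡p∪⁅y⁆∪⁅x⁆ J' i q)
            (Up-extend hJ'∪i (x∉p∧x≢y⇒x∉p∪⁅y⁆ q∉J' (i≢q ∘ sym)))

proposition3p4 : ∀ (n : ℕ) (H : Family (suc n)) → IsMatroid H → IsMatroid (Up H)
proposition3p4 n H matroid = record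
  { isComplex = Up-isSimplicialComplex (IsMatroid.isComplex matroid)
  ; exchange  = Up-exchange matroid
  }
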